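{- Let $\Sigma$ be a finite alphabet. For every string $s\in\Sigma^*$ of length $n$ there exists a $\mathsf{K}_{\mathrm{t}}[\#]$ formula $\phi_s$ of modal depth $n$ such that for every nonempty $w\in\Sigma^*$, $w$ end-satisfies $\phi_s$ if and only if $w$ contains $s$ as a (not necessarily contiguous) subsequence.
   Context: Strings are $w=w_1\cdots w_m$ with $m\ge1$. The logic $\mathsf{K}_{\mathrm{t}}[\#]$: formulas $F ::= Q_a \mid \lnot F \mid F\land F \mid C\le C \mid \top$ ($a\in\Sigma$), count terms $C ::= \#[F] \mid C+C \mid C-C \mid 1$, interpreted at position $i\in[1,m]$: $\#[F]^{w,i}=|\{j\in[1,i]: w,j\vDash F\}|$, $(C_1\pm C_2)^{w,i}=C_1^{w,i}\pm C_2^{w,i}$, $1^{w,i}=1$; $w,i\vDash Q_a$ iff $w_i=a$; $\lnot,\land$ as usual; $w,i\vDash C_1\le C_2$ iff $C_1^{w,i}\le C_2^{w,i}$; $\top$ always holds. Natural-number constants abbreviate sums of $1$'s, and $\ge$, $=$ are the usual abbreviations. $w$ of length $m$ end-satisfies $\phi$ iff $w,m\vDash\phi$. Modal depth: $\mathrm{md}(Q_a)=\mathrm{md}(\top)=\mathrm{md}(1)=0$, $\mathrm{md}(\lnot\phi)=\mathrm{md}(\phi)$, $\mathrm{md}(\#[\phi])=1+\mathrm{md}(\phi)$, and binary constructs ($\land$, $\le$, $+$, $-$) take the maximum of the modal depths of their parts. -}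

module Defs where

open import Data.Nat using (ℕ; zero; suc; _⊔_) renaming (_≤ᵇ_ to _≤ⁿᵇ_)
open import Data.Fin using (Fin; toℕ; fromℕ) renaming (zero to fz; suc to fs)
import Data.Fin as Fin
open import Data.List.Base using (allFin)
open import Data.Product using (Σ; _×_)
open import Data.Integer using (ℤ; +_; _+_; _-_; _≤ᵇ_)
open import Data.Bool using (Bool; true; false; not; _∧_; if_then_else_)
open import Data.List using (List; []; _∷_; length)
open import Relation.Nullary.Decidable using (⌊_⌋)
open import Relation.Binary using (DecidableEquality)
open import Relation.Binary.PropositionalEquality using (_≡_)

mutual
  data Form (A : Set) : Set where
    Q    : A → Form A
    ¬'   : Form A → Form A
    _∧'_ : Form A → Form A → Form A
    _≤'_ : Cnt A → Cnt A → Form A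
    ⊤'   : Form A

  data Cnt (A : Set) : Set where
    #[_] : Form A → Cnt A
    _+'_ : Cnt A → Cnt A → Cnt A
    _-'_ : Cnt A → Cnt A → Cnt A
    one  : Cnt A

mutual
  md : ∀ {A} → Form A → ℕ
  md (Q a)      = 0
  md (¬' φ)     = md φ
  md (φ ∧' ψ)   = md φ ⊔ md ψ
  md (c ≤' d)   = mdC c ⊔ mdC d
  md ⊤'         = 0

  mdC : ∀ {A} → Cnt A → ℕ
  mdC #[ φ ]    = suc (md φ)
  mdC (c +' d)  = mdC c ⊔ mdC d
  mdC (c -' d)  = mdC c ⊔ mdC d
  mdC one       = 0

-- Semantics. A string of length m is a function w : Fin m → A;
-- position p : Fin m stands for the 1-based position toℕ p + 1.
module Semantics {A : Set} (_≟_ : DecidableEquality A) where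

  mutual
    sat : ∀ {m} → (Fin m → A) → Fin m → Form A → Bool
    sat w p (Q a)    = ⌊ w p ≟ a ⌋
    sat w p (¬' φ)   = not (sat w p φ)
    sat w p (φ ∧' ψ) = sat w p φ ∧ sat w p ψ
    sat w p (c ≤' d) = val w p c ≤ᵇ val w p d
    sat w p ⊤'       = true

    val : ∀ {m} → (Fin m → A) → Fin m → Cnt A → ℤ
    val w p #[ φ ]   = count w φ p
    val w p (c +' d) = val w p c + val w p d
    val w p (c -' d) = val w p c - val w p d
    val w p one      = + 1

    count : ∀ {m} → (Fin m → A) → Form A → Fin m → ℤ
    count {m} w φ p = cnt w φ (allFin m) (toℕ p)

    cnt : ∀ {m} → (Fin m → A) → Form A → List (Fin m) → ℕ → ℤ
    cnt w φ []       b = + 0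
    cnt w φ (j ∷ js) b =
      (if (toℕ j ≤ⁿᵇ b) ∧ sat w j φ then + 1 else + 0) + cnt w φ js b

  EndSat : ∀ {n} → (Fin (suc n) → A) → Form A → Set
  EndSat {n} w φ = sat w (fromℕ n) φ ≡ true

IsSubseq : ∀ {A : Set} {k m} → (Fin k → A) → (Fin m → A) → Set
IsSubseq {A} {k} {m} s w =
  Σ (Fin k → Fin m) λ f → ((i j : Fin k) → i Fin.< j → f i Fin.< f j) × ((i : Fin k) → w (f i) ≡ s i)

-- A string s·a occurs as a subsequence strictly before position p iff some j < p carries the
-- letter a and s occurs strictly before j. Unfolding this from the last letter of s costs one
-- counting modality per letter, because the strict past "φ held at some j < p" is expressible:
-- #[φ] at p counts p itself exactly when φ holds now, so it is #[φ] ≥ 2 ∨ (¬φ ∧ #[φ] ≥ 1).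
-- For the last letter of s any position up to the end is allowed, which is just #[φ] ≥ 1.
module Submission where

open import Defs
open import Data.Bool using (Bool; true; false; not; _∧_; T)
open import Data.Bool.Properties using (T-≡; T-∧; T?)
open import Data.Empty using (⊥-elim)
open import Data.Fin as Fin using (Fin; _≟_; toℕ; fromℕ; inject₁) renaming (zero to fz; suc to fs)
open import Data.Fin.Properties using (toℕ-inject₁; toℕ-fromℕ; toℕ<n; ≤fromℕ; fromℕ≢inject₁; ≤∧≢⇒<)
open import Data.Integer using (+_)
open import Data.List using (List; []; _∷_; allFin)
open import Data.List.Membership.Propositional using (_∈_; lose; find)
open import Data.List.Membership.Propositional.Properties using (∈-allFin)
import Data.List.Relation.Unary.All as All
open import Data.List.Relation.Unary.AllPairs using (_∷_)
open import Data.List.Relation.Unary.Any using (Any; here; there; satisfied)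
open import Data.List.Relation.Unary.Unique.Propositional using (Unique)
open import Data.List.Relation.Unary.Unique.Propositional.Properties using (allFin⁺)
open import Data.Nat using (ℕ; zero; suc; _≤_; _<_; _≤ᵇ_; z≤n; s≤s; s≤s⁻¹)
open import Data.Nat.Properties using (≤ᵇ⇒≤; ≤⇒≤ᵇ; ≤-refl; <⇒≤; <⇒≢; ≤⇒≯; m≤n⇒m≤1+n; m<n⇒m<1+n; <-trans; n≤1+n; m≤n⇒m⊔n≡n; ⊔-idem)
open import Data.Product using (Σ; _×_; _,_; ∃-syntax; proj₁; map₂)
open import Data.Product.Function.NonDependent.Propositional using (_×-⇔_)
open import Data.Sum using (_⊎_; inj₁; inj₂)
open import Data.Vec.Functional using (init; last)
open import Function using (_∘_)
open import Function.Bundles using (_⇔_; mk⇔; Equivalence)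
open import Function.Construct.Identity using (⇔-id)
open import Function.Related.Propositional using (module EquationalReasoning)
open import Function.Properties.Equivalence using () renaming (trans to ⇔-trans; sym to ⇔-sym)
open import Relation.Binary using (DecidableEquality)
open import Relation.Binary.PropositionalEquality using (_≡_; _≢_; refl; sym; cong; subst; subst₂)
open import Relation.Nullary using (¬_; yes; no; contradiction)
open import Relation.Nullary.Decidable using (toWitness; fromWitness)

open Equivalence using (to; from)

T-not⇔¬T : ∀ {b} → T (not b) ⇔ (¬ T b)
T-not⇔¬T {true}  = mk⇔ (λ ()) (λ ¬t → ¬t _)
T-not⇔¬T {false} = mk⇔ (λ _ ()) _

T-not-∧-not : ∀ a b → T (not (not a ∧ not b)) ⇔ (T a ⊎ T b)
T-not-∧-not true  _     = mk⇔ inj₁ _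
T-not-∧-not false true  = mk⇔ inj₂ _
T-not-∧-not false false = mk⇔ (λ ()) λ { (inj₁ ()) ; (inj₂ ()) }

∃-⇔ : ∀ {X : Set} {P Q : X → Set} → (∀ {x} → P x ⇔ Q x) → (∃[ x ] P x) ⇔ (∃[ x ] Q x)
∃-⇔ P⇔Q = mk⇔ (map₂ (to P⇔Q)) (map₂ (from P⇔Q))

module _ {X : Set} (B : X → Bool) where

  countᵇ : List X → ℕ
  countᵇ []       = 0
  countᵇ (x ∷ xs) with B x
  ... | true  = suc (countᵇ xs)
  ... | false = countᵇ xs

  Any⇒1≤countᵇ : ∀ {xs} → Any (T ∘ B) xs → 1 ≤ countᵇ xs
  Any⇒1≤countᵇ {x ∷ _} (here Bx) with B x
  ... | true  = s≤s z≤n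
  ... | false = ⊥-elim Bx
  Any⇒1≤countᵇ {x ∷ _} (there any) with B x
  ... | true  = s≤s z≤n
  ... | false = Any⇒1≤countᵇ any

  1≤countᵇ⇒Any : ∀ xs → 1 ≤ countᵇ xs → Any (T ∘ B) xs
  1≤countᵇ⇒Any (x ∷ xs) c with B x in Bx
  ... | true  = here (from T-≡ Bx)
  ... | false = there (1≤countᵇ⇒Any xs c)

  2≤countᵇ : ∀ {x y xs} → x ∈ xs → y ∈ xs → x ≢ y → T (B x) → T (B y) → 2 ≤ countᵇ xs
  2≤countᵇ (here refl) (here refl) x≢y _ _ = contradiction refl x≢y
  2≤countᵇ {x} (here refl) (there y∈xs) _ Bx By with B x
  ... | true  = s≤s (Any⇒1≤countᵇ (lose y∈xs By))
  ... | false = ⊥-elim Bx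
  2≤countᵇ {y = y} (there x∈xs) (here refl) _ Bx By with B y
  ... | true  = s≤s (Any⇒1≤countᵇ (lose x∈xs Bx))
  ... | false = ⊥-elim By
  2≤countᵇ {xs = z ∷ _} (there x∈xs) (there y∈xs) x≢y Bx By with B z
  ... | true  = m≤n⇒m≤1+n (2≤countᵇ x∈xs y∈xs x≢y Bx By)
  ... | false = 2≤countᵇ x∈xs y∈xs x≢y Bx By

  -- Unique xs makes the counted witnesses distinct, and _≟_ picks one that is not z.
  2≤countᵇ⇒∃≢ : DecidableEquality X → ∀ {xs} → Unique xs → 2 ≤ countᵇ xs →
                ∀ z → ∃[ x ] (T (B x) × x ≢ z)
  2≤countᵇ⇒∃≢ _≟_ {x ∷ xs} (x∉xs ∷ unique) c z with B x in Bx
  ... | false = 2≤countᵇ⇒∃≢ _≟_ unique c z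
  ... | true with x ≟ z
  ...   | no x≢z = x , from T-≡ Bx , x≢z
  ...   | yes refl =
    let y , y∈xs , By = find (1≤countᵇ⇒Any xs (s≤s⁻¹ c))
    in  y , By , λ y≡x → All.lookup x∉xs y∈xs (sym y≡x)

_∨'_ : ∀ {A} → Form A → Form A → Form A
φ ∨' ψ = ¬' (¬' φ ∧' ¬' ψ)

two : ∀ {A} → Cnt A
two = one +' one

once : ∀ {A} → Form A → Form A
once φ = one ≤' #[ φ ]

onceBefore : ∀ {A} → Form A → Form A
onceBefore φ = (two ≤' #[ φ ]) ∨' (¬' φ ∧' once φ)

mutual
  occursBefore : ∀ {A n} → (Fin n → A) → Form A
  occursBefore {n = zero}  s = ⊤'
  occursBefore {n = suc n} s = onceBefore (endsHere s)

  endsHere : ∀ {A n} → (Fin (suc n) → A) → Form A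
  endsHere s = Q (last s) ∧' occursBefore (init s)

occursUpTo : ∀ {A n} → (Fin n → A) → Form A
occursUpTo {n = zero}  s = ⊤'
occursUpTo {n = suc n} s = once (endsHere s)

md-onceBefore : ∀ {A} (φ : Form A) → md (onceBefore φ) ≡ suc (md φ)
md-onceBefore φ rewrite m≤n⇒m⊔n≡n (n≤1+n (md φ)) = ⊔-idem (suc (md φ))

md-occursBefore : ∀ {A n} (s : Fin n → A) → md (occursBefore s) ≡ n
md-occursBefore {n = zero}  s = refl
md-occursBefore {n = suc n} s rewrite md-onceBefore (endsHere s) = cong suc (md-occursBefore (init s))

md-occursUpTo : ∀ {A n} (s : Fin n → A) → md (occursUpTo s) ≡ n
md-occursUpTo {n = zero}  s = refl
md-occursUpTo {n = suc n} s = cong suc (md-occursBefore (init s))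

data LastOrInject₁ : ∀ {n} → Fin (suc n) → Set where
  is-last    : ∀ {n} → LastOrInject₁ (fromℕ n)
  is-inject₁ : ∀ {n} (i : Fin n) → LastOrInject₁ (inject₁ i)

lastOrInject₁ : ∀ {n} (i : Fin (suc n)) → LastOrInject₁ i
lastOrInject₁ {zero}  fz     = is-last
lastOrInject₁ {suc n} fz     = is-inject₁ fz
lastOrInject₁ {suc n} (fs i) with lastOrInject₁ i
... | is-last      = is-last
... | is-inject₁ j = is-inject₁ (fs j)

_∷ʳ_ : ∀ {X : Set} {n} → (Fin n → X) → X → Fin (suc n) → X
_∷ʳ_ {n = zero}  g x _      = x
_∷ʳ_ {n = suc n} g x fz     = g fz
_∷ʳ_ {n = suc n} g x (fs i) = ((g ∘ fs) ∷ʳ x) i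

∷ʳ-fromℕ : ∀ {X : Set} {n} (g : Fin n → X) x → (g ∷ʳ x) (fromℕ n) ≡ x
∷ʳ-fromℕ {n = zero}  g x = refl
∷ʳ-fromℕ {n = suc n} g x = ∷ʳ-fromℕ (g ∘ fs) x

∷ʳ-inject₁ : ∀ {X : Set} {n} (g : Fin n → X) x i → (g ∷ʳ x) (inject₁ i) ≡ g i
∷ʳ-inject₁ {n = suc n} g x fz     = refl
∷ʳ-inject₁ {n = suc n} g x (fs i) = ∷ʳ-inject₁ (g ∘ fs) x i

inject₁<fromℕ : ∀ {n} (i : Fin n) → inject₁ i Fin.< fromℕ n
inject₁<fromℕ i = ≤∧≢⇒< (≤fromℕ (inject₁ i)) (fromℕ≢inject₁ ∘ sym)

module _ {A : Set} {M : ℕ} (w : Fin M → A) where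

  IsSubseqBelow : ∀ {n} → ℕ → (Fin n → A) → Set
  IsSubseqBelow b s = Σ (IsSubseq s w) λ e → ∀ i → toℕ (proj₁ e i) < b

  IsSubseqBelow-[] : ∀ {b} (s : Fin 0 → A) → IsSubseqBelow b s
  IsSubseqBelow-[] s = ((λ ()) , (λ ()) , (λ ())) , (λ ())

  IsSubseqBelow⇔IsSubseq : ∀ {n} {s : Fin n → A} → IsSubseqBelow M s ⇔ IsSubseq s w
  IsSubseqBelow⇔IsSubseq = mk⇔ proj₁ (λ e → e , toℕ<n ∘ proj₁ e)

  ∃last⇔IsSubseqBelow : ∀ {n} {s : Fin (suc n) → A} {b} →
    (∃[ j ] (toℕ j < b × w j ≡ last s × IsSubseqBelow (toℕ j) (init s))) ⇔ IsSubseqBelow b s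
  ∃last⇔IsSubseqBelow {n} {s} {b} = mk⇔ extend restrict
    where
    extend : ∃[ j ] (toℕ j < b × w j ≡ last s × IsSubseqBelow (toℕ j) (init s)) → IsSubseqBelow b s
    extend (j , j<b , wj≡ , (g , g-mono , g-match) , g<j) = (g ∷ʳ j , mono , match) , below
      where
      mono : ∀ i i′ → i Fin.< i′ → (g ∷ʳ j) i Fin.< (g ∷ʳ j) i′
      mono i i′ i<i′ with lastOrInject₁ i | lastOrInject₁ i′
      ... | is-last      | _ = ⊥-elim (≤⇒≯ (≤fromℕ i′) i<i′)
      ... | is-inject₁ a | is-last rewrite ∷ʳ-inject₁ g j a | ∷ʳ-fromℕ g j = g<j a
      ... | is-inject₁ a | is-inject₁ a′ rewrite ∷ʳ-inject₁ g j a | ∷ʳ-inject₁ g j a′ =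
        g-mono a a′ (subst₂ _<_ (toℕ-inject₁ a) (toℕ-inject₁ a′) i<i′)
      match : ∀ i → w ((g ∷ʳ j) i) ≡ s i
      match i with lastOrInject₁ i
      ... | is-last      rewrite ∷ʳ-fromℕ g j = wj≡
      ... | is-inject₁ a rewrite ∷ʳ-inject₁ g j a = g-match a
      below : ∀ i → toℕ ((g ∷ʳ j) i) < b
      below i with lastOrInject₁ i
      ... | is-last      rewrite ∷ʳ-fromℕ g j = j<b
      ... | is-inject₁ a rewrite ∷ʳ-inject₁ g j a = <-trans (g<j a) j<b
    restrict : IsSubseqBelow b s → ∃[ j ] (toℕ j < b × w j ≡ last s × IsSubseqBelow (toℕ j) (init s))
    restrict ((f , f-mono , f-match) , f<b) =
      f (fromℕ n) , f<b (fromℕ n) , f-match (fromℕ n) ,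
      ( f ∘ inject₁
      , (λ i i′ i<i′ → f-mono (inject₁ i) (inject₁ i′) (subst₂ _<_ (sym (toℕ-inject₁ i)) (sym (toℕ-inject₁ i′)) i<i′))
      , f-match ∘ inject₁ )
      , λ i → f-mono (inject₁ i) (fromℕ n) (inject₁<fromℕ i)

module _ {A : Set} (_≟A_ : DecidableEquality A) where
  open Semantics _≟A_

  module _ {M : ℕ} (w : Fin M → A) where

    holdsUpTo : Fin M → Form A → Fin M → Bool
    holdsUpTo p φ j = (toℕ j ≤ᵇ toℕ p) ∧ sat w j φ

    T-holdsUpTo : ∀ {p} φ {j} → T (holdsUpTo p φ j) ⇔ (toℕ j ≤ toℕ p × T (sat w j φ))
    T-holdsUpTo φ = ⇔-trans T-∧ (mk⇔ (≤ᵇ⇒≤ _ _) ≤⇒≤ᵇ ×-⇔ ⇔-id _)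

    #≤ : Form A → Fin M → ℕ
    #≤ φ p = countᵇ (holdsUpTo p φ) (allFin M)

    cnt≡countᵇ : ∀ φ js b → cnt w φ js b ≡ + countᵇ (λ j → (toℕ j ≤ᵇ b) ∧ sat w j φ) js
    cnt≡countᵇ φ []       b = refl
    cnt≡countᵇ φ (j ∷ js) b rewrite cnt≡countᵇ φ js b with (toℕ j ≤ᵇ b) ∧ sat w j φ
    ... | true  = refl
    ... | false = refl

    sat-≤# : ∀ c {n} φ p → val w p c ≡ + n → T (sat w p (c ≤' #[ φ ])) ⇔ n ≤ #≤ φ p
    sat-≤# c φ p c≡n rewrite c≡n | cnt≡countᵇ φ (allFin M) (toℕ p) = mk⇔ (≤ᵇ⇒≤ _ _) ≤⇒≤ᵇ

    sat-∨' : ∀ φ ψ {p} → T (sat w p (φ ∨' ψ)) ⇔ (T (sat w p φ) ⊎ T (sat w p ψ))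
    sat-∨' φ ψ {p} = T-not-∧-not (sat w p φ) (sat w p ψ)

    sat-once : ∀ φ {p} → T (sat w p (once φ)) ⇔ (∃[ j ] (toℕ j < suc (toℕ p) × T (sat w j φ)))
    sat-once φ {p} = mk⇔ witness ofWitness
      where
      witness : T (sat w p (once φ)) → ∃[ j ] (toℕ j < suc (toℕ p) × T (sat w j φ))
      witness h =
        let j , j∈ = satisfied (1≤countᵇ⇒Any (holdsUpTo p φ) (allFin M) (to (sat-≤# one φ p refl) h))
            j≤p , φj = to (T-holdsUpTo φ) j∈
        in  j , s≤s j≤p , φj
      ofWitness : ∃[ j ] (toℕ j < suc (toℕ p) × T (sat w j φ)) → T (sat w p (once φ))
      ofWitness (j , s≤s j≤p , φj) =
        from (sat-≤# one φ p refl)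
          (Any⇒1≤countᵇ (holdsUpTo p φ) (lose (∈-allFin j) (from (T-holdsUpTo φ) (j≤p , φj))))

    sat-onceBefore : ∀ φ {p} → T (sat w p (onceBefore φ)) ⇔ (∃[ j ] (toℕ j < toℕ p × T (sat w j φ)))
    sat-onceBefore φ {p} = mk⇔ witness ofWitness
      where
      twiceOrOnceNotNow : T (sat w p (onceBefore φ)) ⇔
                          (T (sat w p (two ≤' #[ φ ])) ⊎ T (sat w p (¬' φ ∧' once φ)))
      twiceOrOnceNotNow = sat-∨' (two ≤' #[ φ ]) (¬' φ ∧' once φ)

      witness : T (sat w p (onceBefore φ)) → ∃[ j ] (toℕ j < toℕ p × T (sat w j φ))
      witness h with to twiceOrOnceNotNow h
      ... | inj₁ twice =
        let j , j∈ , j≢p = 2≤countᵇ⇒∃≢ (holdsUpTo p φ) _≟_ (allFin⁺ M) (to (sat-≤# two φ p refl) twice) p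
            j≤p , φj = to (T-holdsUpTo φ) j∈
        in  j , ≤∧≢⇒< j≤p j≢p , φj
      ... | inj₂ onceNotNow =
        let ¬φp , onceφ = to T-∧ onceNotNow
            j , j<1+p , φj = to (sat-once φ) onceφ
            j≢p = λ j≡p → to T-not⇔¬T ¬φp (subst (λ i → T (sat w i φ)) j≡p φj)
        in  j , ≤∧≢⇒< (s≤s⁻¹ j<1+p) j≢p , φj

      ofWitness : ∃[ j ] (toℕ j < toℕ p × T (sat w j φ)) → T (sat w p (onceBefore φ))
      ofWitness (j , j<p , φj) with T? (sat w p φ)
      ... | yes φp = from twiceOrOnceNotNow (inj₁ (from (sat-≤# two φ p refl)
        (2≤countᵇ (holdsUpTo p φ) (∈-allFin j) (∈-allFin p) (<⇒≢ j<p ∘ cong toℕ)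
          (from (T-holdsUpTo φ) (<⇒≤ j<p , φj)) (from (T-holdsUpTo φ) (≤-refl , φp)))))
      ... | no ¬φp = from twiceOrOnceNotNow (inj₂ (from T-∧
        (from T-not⇔¬T ¬φp , from (sat-once φ) (j , m<n⇒m<1+n j<p , φj))))

    mutual
      sat-occursBefore : ∀ {n} (s : Fin n → A) {p} → T (sat w p (occursBefore s)) ⇔ IsSubseqBelow w (toℕ p) s
      sat-occursBefore {zero}  s     = mk⇔ (λ _ → IsSubseqBelow-[] w s) _
      sat-occursBefore {suc n} s {p} = begin
        T (sat w p (onceBefore (endsHere s)))
          ∼⟨ sat-onceBefore (endsHere s) ⟩
        (∃[ j ] (toℕ j < toℕ p × T (sat w j (endsHere s))))
          ∼⟨ ∃-⇔ (⇔-id _ ×-⇔ sat-endsHere s) ⟩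
        (∃[ j ] (toℕ j < toℕ p × w j ≡ last s × IsSubseqBelow w (toℕ j) (init s)))
          ∼⟨ ∃last⇔IsSubseqBelow w ⟩
        IsSubseqBelow w (toℕ p) s ∎
        where open EquationalReasoning

      sat-endsHere : ∀ {n} (s : Fin (suc n) → A) {j} →
                     T (sat w j (endsHere s)) ⇔ (w j ≡ last s × IsSubseqBelow w (toℕ j) (init s))
      sat-endsHere s = ⇔-trans T-∧ (mk⇔ toWitness fromWitness ×-⇔ sat-occursBefore (init s))

    sat-occursUpTo : ∀ {n} (s : Fin n → A) {p} → T (sat w p (occursUpTo s)) ⇔ IsSubseqBelow w (suc (toℕ p)) s
    sat-occursUpTo {zero}  s     = mk⇔ (λ _ → IsSubseqBelow-[] w s) _
    sat-occursUpTo {suc n} s {p} = begin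
      T (sat w p (once (endsHere s)))
        ∼⟨ sat-once (endsHere s) ⟩
      (∃[ j ] (toℕ j < suc (toℕ p) × T (sat w j (endsHere s))))
        ∼⟨ ∃-⇔ (⇔-id _ ×-⇔ sat-endsHere s) ⟩
      (∃[ j ] (toℕ j < suc (toℕ p) × w j ≡ last s × IsSubseqBelow w (toℕ j) (init s)))
        ∼⟨ ∃last⇔IsSubseqBelow w ⟩
      IsSubseqBelow w (suc (toℕ p)) s ∎
      where open EquationalReasoning

lemma1 : (k : ℕ) (n : ℕ) (s : Fin n → Fin k) →
    Σ (Form (Fin k)) λ φ → (md φ ≡ n) ×
      ((m : ℕ) (w : Fin (suc m) → Fin k) → Semantics.EndSat _≟_ w φ ⇔ IsSubseq s w)
lemma1 k n s = occursUpTo s , md-occursUpTo s , endSat⇔IsSubseq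
  where
  open Semantics {Fin k} _≟_
  open EquationalReasoning
  endSat⇔IsSubseq : (m : ℕ) (w : Fin (suc m) → Fin k) → EndSat w (occursUpTo s) ⇔ IsSubseq s w
  endSat⇔IsSubseq m w = begin
    EndSat w (occursUpTo s)                   ∼⟨ ⇔-sym T-≡ ⟩
    T (sat w (fromℕ m) (occursUpTo s))        ∼⟨ sat-occursUpTo _≟_ w s ⟩
    IsSubseqBelow w (suc (toℕ (fromℕ m))) s   ≡⟨ cong (λ b → IsSubseqBelow w (suc b) s) (toℕ-fromℕ m) ⟩
    IsSubseqBelow w (suc m) s                 ∼⟨ IsSubseqBelow⇔IsSubseq w ⟩
    IsSubseq s w                              ∎
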